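{- Let $p$ be a prime, $f \in \mathbb{Z}[x]$, and $n$ a positive integer. Then $D_f(n) \le D_{pf}(n) \le p\, D_f(n)$, where $pf$ denotes the polynomial $x \mapsto p f(x)$.
   Context: For $g \in \mathbb{Z}[x]$ and $n \in \mathbb{Z}^{+}$, the discriminator $D_g(n)$ is the smallest positive integer $m$ such that $g(1), g(2), \ldots, g(n)$ are pairwise distinct modulo $m$; if no such $m$ exists, $D_g(n) = \infty$. -}

module Defs where

open import Data.Nat using (ℕ; suc; _<_; _≤_)
open import Data.Integer using (ℤ; +_; _+_; _*_; _-_)
open import Data.Integer.Divisibility using (_∣_)
open import Data.List using (List; []; _∷_; map)
open import Data.Product using (_×_)
open import Relation.Nullary using (¬_)

-- A polynomial in ℤ[x] as its list of coefficients, constant term first: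
-- a₀ ∷ a₁ ∷ … represents a₀ + a₁ x + …
Poly : Set
Poly = List ℤ

eval : Poly → ℤ → ℤ
eval []       x = + 0
eval (a ∷ as) x = a + x * eval as x

scale : ℤ → Poly → Poly
scale c g = map (c *_) g

_≡_[mod_] : ℤ → ℤ → ℕ → Set
a ≡ b [mod m ] = (+ m) ∣ (a - b)

Distinguishes : Poly → ℕ → ℕ → Set
Distinguishes g n m =
  ∀ i j → 1 ≤ i → i ≤ n → 1 ≤ j → j ≤ n → i < j →
    ¬ (eval g (+ i) ≡ eval g (+ j) [mod m ])

IsDiscriminator : Poly → ℕ → ℕ → Set
IsDiscriminator g n m =
  1 ≤ m × Distinguishes g n m × (∀ k → 1 ≤ k → k < m → ¬ Distinguishes g n k)

{-# OPTIONS --safe #-}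
-- Since p·f(i) − p·f(j) = p·(f(i) − f(j)), a congruence f(i) ≡ f(j) (mod m) gives
-- p·f(i) ≡ p·f(j) (mod m), and a congruence p·f(i) ≡ p·f(j) (mod p·m) gives back
-- f(i) ≡ f(j) (mod m). Hence every modulus separating p·f separates f, and every m
-- separating f yields p·m separating p·f; minimality of the discriminators then gives
-- both inequalities. Separation by a given modulus is decidable, so whenever some
-- modulus separates, a least one exists.
module Submission where

open import Defs
open import Data.Nat using (ℕ; suc; _≤_; _<_; _*_; _≤?_; _<?_; NonZero; s≤s)
open import Data.Nat.Primality using (Prime; prime⇒nonZero)
open import Data.Integer using (+_)
open import Data.Product using (_×_; ∃; _,_)
open import Function.Bundles using (_⇔_; mk⇔)

import Data.Nat.Divisibility as ℕ
open import Data.Nat.Properties using (anyUpTo?; allUpTo?; ≤-refl; ≤-trans; ≤-pred; <-≤-trans; ≰⇒>; m≤n*m)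
import Data.Integer as ℤ
import Data.Integer.Properties as ℤ
import Data.Integer.Divisibility as ℤ
import Data.Integer.Divisibility.Signed as Signed
open import Data.List using ([]; _∷_)
open import Relation.Binary.PropositionalEquality using (_≡_; sym; cong; subst; subst₂; module ≡-Reasoning)
open import Relation.Nullary using (¬_; Dec; yes; no; contradiction)
open import Relation.Nullary.Decidable using (map′; ¬?; _×-dec_; _→-dec_)
open import Relation.Unary using (Pred; Decidable)
open import Algebra.Properties.CommutativeSemigroup ℤ.*-commutativeSemigroup using (x∙yz≈y∙xz)

eval-scale : ∀ c g x → eval (scale c g) x ≡ c ℤ.* eval g x
eval-scale c []       x = sym (ℤ.*-zeroʳ c)
eval-scale c (a ∷ as) x = begin
  c ℤ.* a ℤ.+ x ℤ.* eval (scale c as) x  ≡⟨ cong (λ t → c ℤ.* a ℤ.+ x ℤ.* t) (eval-scale c as x) ⟩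
  c ℤ.* a ℤ.+ x ℤ.* (c ℤ.* eval as x)    ≡⟨ cong (ℤ._+_ (c ℤ.* a)) (x∙yz≈y∙xz x c _) ⟩
  c ℤ.* a ℤ.+ c ℤ.* (x ℤ.* eval as x)    ≡⟨ ℤ.*-distribˡ-+ c a _ ⟨
  c ℤ.* (a ℤ.+ x ℤ.* eval as x)          ∎
  where open ≡-Reasoning

*-distribˡ-minus : ∀ c a b → c ℤ.* a ℤ.- c ℤ.* b ≡ c ℤ.* (a ℤ.- b)
*-distribˡ-minus c a b = begin
  c ℤ.* a ℤ.+ ℤ.- (c ℤ.* b)  ≡⟨ cong (ℤ._+_ (c ℤ.* a)) (ℤ.neg-distribʳ-* c b) ⟩
  c ℤ.* a ℤ.+ c ℤ.* ℤ.- b    ≡⟨ ℤ.*-distribˡ-+ c a (ℤ.- b) ⟨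
  c ℤ.* (a ℤ.- b)            ∎
  where open ≡-Reasoning

_≡?_[mod_] : ∀ a b m → Dec (a ≡ b [mod m ])
a ≡? b [mod m ] = m ℕ.∣? ℤ.∣ a ℤ.- b ∣

*-congˡ-mod : ∀ c {a b m} → a ≡ b [mod m ] → (c ℤ.* a) ≡ (c ℤ.* b) [mod m ]
*-congˡ-mod c {a} {b} {m} a≡b = subst (ℤ._∣_ (+ m)) (sym (*-distribˡ-minus c a b))
  (Signed.∣⇒∣ᵤ (Signed.∣n⇒∣m*n c (Signed.∣ᵤ⇒∣ {+ m} a≡b)))

*-cancelˡ-mod : ∀ c {a b m} .{{_ : NonZero c}} →
  (+ c ℤ.* a) ≡ (+ c ℤ.* b) [mod c * m ] → a ≡ b [mod m ]
*-cancelˡ-mod c {a} {b} {m} ca≡cb = ℤ.*-cancelˡ-∣ (+ c)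
  (subst₂ ℤ._∣_ (ℤ.pos-* c m) (*-distribˡ-minus (+ c) a b) ca≡cb)

distinguishes-transfer : ∀ {g h n m k} →
  (∀ i j → eval g (+ i) ≡ eval g (+ j) [mod m ] → eval h (+ i) ≡ eval h (+ j) [mod k ]) →
  Distinguishes h n k → Distinguishes g n m
distinguishes-transfer g→h D i j 1≤i i≤n 1≤j j≤n i<j gi≡gj = D i j 1≤i i≤n 1≤j j≤n i<j (g→h i j gi≡gj)

distinguishes-unscale : ∀ c g n m → Distinguishes (scale c g) n m → Distinguishes g n m
distinguishes-unscale c g n m = distinguishes-transfer {g} {scale c g} λ i j gi≡gj →
  subst₂ (_≡_[mod m ]) (sym (eval-scale c g (+ i))) (sym (eval-scale c g (+ j))) (*-congˡ-mod c gi≡gj)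

distinguishes-scale : ∀ c g n m .{{_ : NonZero c}} →
  Distinguishes g n m → Distinguishes (scale (+ c) g) n (c * m)
distinguishes-scale c g n m = distinguishes-transfer {scale (+ c) g} {g} λ i j cgi≡cgj →
  *-cancelˡ-mod c (subst₂ (_≡_[mod c * m ]) (eval-scale (+ c) g (+ i)) (eval-scale (+ c) g (+ j)) cgi≡cgj)

distinguishes? : ∀ g n m → Dec (Distinguishes g n m)
distinguishes? g n m = map′
  (λ D i j 1≤i i≤n 1≤j j≤n → D {i} (s≤s i≤n) {j} (s≤s j≤n) 1≤i 1≤j)
  (λ D {i} i<1+n {j} j<1+n 1≤i 1≤j → D i j 1≤i (≤-pred i<1+n) 1≤j (≤-pred j<1+n))
  (allUpTo? (λ i → allUpTo? (separated? i) (suc n)) (suc n))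
  where
  separated? : ∀ i j → Dec (1 ≤ i → 1 ≤ j → i < j → ¬ (eval g (+ i) ≡ eval g (+ j) [mod m ]))
  separated? i j = (1 ≤? i) →-dec (1 ≤? j) →-dec (i <? j) →-dec ¬? (eval g (+ i) ≡? eval g (+ j) [mod m ])

module _ {p} {P : Pred ℕ p} (P? : Decidable P) where

  least-witness-below : ∀ v → (∃ λ n → n < v × P n) → ∃ λ m → P m × (∀ {k} → k < m → ¬ P k)
  least-witness-below (suc v) (n , s≤s n≤v , Pn) with anyUpTo? P? v
  ... | yes w = least-witness-below v w
  ... | no ∄ = n , Pn , λ k<n Pk → ∄ (_ , <-≤-trans k<n n≤v , Pk)

  least-witness : ∀ {M} → P M → ∃ λ m → P m × (∀ {k} → k < m → ¬ P k)
  least-witness {M} PM = least-witness-below (suc M) (M , ≤-refl , PM)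

discriminator-exists : ∀ g n M → 1 ≤ M → Distinguishes g n M → ∃ (IsDiscriminator g n)
discriminator-exists g n M 1≤M D with least-witness (λ k → (1 ≤? k) ×-dec distinguishes? g n k) (1≤M , D)
... | m , (1≤m , Dm) , minimal = m , 1≤m , Dm , λ k 1≤k k<m Dk → minimal k<m (1≤k , Dk)

discriminator-minimal : ∀ g n {m k} → IsDiscriminator g n m → 1 ≤ k → Distinguishes g n k → m ≤ k
discriminator-minimal g n {m} {k} (_ , _ , below) 1≤k Dk with m ≤? k
... | yes m≤k = m≤k
... | no m≰k = contradiction Dk (below k 1≤k (≰⇒> m≰k))

theorem4 : (p : ℕ) → Prime p → (f : Poly) → (n : ℕ) → 1 ≤ n →
    ((∃ λ m → IsDiscriminator f n m) ⇔ (∃ λ m → IsDiscriminator (scale (+ p) f) n m))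
    × (∀ m m′ → IsDiscriminator f n m → IsDiscriminator (scale (+ p) f) n m′ →
         m ≤ m′ × m′ ≤ p * m)
theorem4 p p-prime f n _ =
  mk⇔ (λ { (m , 1≤m , D , _) → discriminator-exists pf n (p * m) (1≤p*m 1≤m) (distinguishes-scale p f n m D) })
      (λ { (m , 1≤m , D , _) → discriminator-exists f n m 1≤m (distinguishes-unscale (+ p) f n m D) })
  , λ { m m′ m-disc@(1≤m , Dm , _) m′-disc@(1≤m′ , Dm′ , _) →
        discriminator-minimal f n m-disc 1≤m′ (distinguishes-unscale (+ p) f n m′ Dm′)
      , discriminator-minimal pf n m′-disc (1≤p*m 1≤m) (distinguishes-scale p f n m Dm) }
  where
  instance _ = prime⇒nonZero p-prime

  pf : Poly
  pf = scale (+ p) f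

  1≤p*m : ∀ {m} → 1 ≤ m → 1 ≤ p * m
  1≤p*m {m} 1≤m = ≤-trans 1≤m (m≤n*m m p)
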